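{- Let $f:\{0,1\}^n\to\{0,1\}^n$ be a Boolean network all of whose attractors (in the asynchronous dynamics) are fixed points, and let $x,y\in\{0,1\}^n$ be two fixed points of $f$ (i.e. $f(x)=x$, $f(y)=y$). (i) Let $u\in[n]$ be a vertex with $x_u\neq y_u$ that does not lie on any positive cycle of the interaction graph $G(f)$. Then for every state $z\in\{0,1\}^n$ with $z_v=y_v$ for all $v\in P_u$, one has $f_u(z)=y_u$ (i.e. putting the ancestors of $u$ at their values in $y$ suffices to drive $u$ to $y_u$). (ii) Let $W\subseteq[n]$ be the union of the vertex sets of all strongly connected components of $G(f)$ that contain at least one positive cycle. Let $f'$ be the Boolean network with $f'_u(z)=y_u$ for all $z$ when $u\in W$, and $f'_u=f_u$ when $u\notin W$, and let $x'=x_{[x_W=y_W]}$. Then, in the asynchronous transition graph of $f'$, every state reachable from $x'$ can reach $y$; in particular $y$ is reachable from $x'$. (That is, permanently fixing only the vertices of the SCCs containing a positive cycle to their values in $y$ suffices to switch from $x$ to $y$.)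
   Context: A Boolean network (BN) of dimension $n$ is a map $f=(f_1,\dots,f_n):\{0,1\}^n\to\{0,1\}^n$; $[n]=\{1,\dots,n\}$. Its interaction graph $G(f)$ has vertex set $[n]$ and, for $u,v\in[n]$, a positive (resp. negative) arc from $u$ to $v$ if the discrete derivative $f_{vu}(z)=f_v(z_1,\dots,z_{u-1},1,z_{u+1},\dots,z_n)-f_v(z_1,\dots,z_{u-1},0,z_{u+1},\dots,z_n)$ is positive (resp. negative) for at least one $z\in\{0,1\}^n$. A cycle is positive if it contains an even number of negative arcs. $P_u$ denotes the set of ancestors of $u$: the vertices $v$ from which there is a directed path to $u$ in $G(f)$. For $z\in\{0,1\}^n$ and $I\subseteq[n]$, $x_{[x_I=y_I]}$ is the state equal to $y$ on $I$ and to $x$ outside $I$; $\bar z^{\{u\}}$ is $z$ with coordinate $u$ flipped. The asynchronous transition graph of a BN $g$ has vertex set $\{0,1\}^n$ and an edge $z\to\bar z^{\{u\}}$ whenever $g_u(z)\neq z_u$; $z\to^* w$ means there is a path from $z$ to $w$. Attractors are the terminal strongly connected components of the transition graph; a fixed point is a single-state attractor, i.e. $g(z)=z$. -}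

module Defs where

open import Level using (Level; 0ℓ) renaming (suc to lsuc)
open import Data.Nat using (ℕ)
open import Data.Bool using (Bool; true; false; not; if_then_else_)
open import Data.Fin using (Fin)
open import Data.Vec using (Vec; lookup; tabulate; _[_]≔_)
open import Data.List using (List; []; _∷_)
open import Data.List.Relation.Unary.Unique.Propositional using (Unique)
open import Data.Product using (Σ; ∃; _×_; _,_)
open import Data.Sum using (_⊎_)
open import Relation.Binary.PropositionalEquality using (_≡_; _≢_)
open import Relation.Binary.Construct.Closure.ReflexiveTransitive using (Star)

State : ℕ → Set
State n = Vec Bool n

BN : ℕ → Set
BN n = State n → State n

module _ {n : ℕ} where

  PosArc : BN n → Fin n → Fin n → Set
  PosArc f u v = Σ (State n) λ z →
    (lookup (f (z [ u ]≔ false)) v ≡ false) × (lookup (f (z [ u ]≔ true)) v ≡ true)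

  NegArc : BN n → Fin n → Fin n → Set
  NegArc f u v = Σ (State n) λ z →
    (lookup (f (z [ u ]≔ false)) v ≡ true) × (lookup (f (z [ u ]≔ true)) v ≡ false)

  SArc : BN n → Bool → Fin n → Fin n → Set
  SArc f true  u v = PosArc f u v
  SArc f false u v = NegArc f u v

  Arc : BN n → Fin n → Fin n → Set
  Arc f u v = PosArc f u v ⊎ NegArc f u v

  -- The list records the visited vertices,
  -- starting vertex included, final vertex excluded.  The Bool index is
  -- the parity: true iff the walk has an even number of negative arcs.
  data SWalk (f : BN n) : Fin n → Fin n → List (Fin n) → Bool → Set where
    [] : ∀ {u} → SWalk f u u [] true
    _∷_ : ∀ {s u v w vs p} → SArc f s u v → SWalk f v w vs p →
          SWalk f u w (u ∷ vs) (if s then p else not p)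

  OnPosCycle : BN n → Fin n → Set
  OnPosCycle f u = Σ (Fin n) λ v → Σ (List (Fin n)) λ vs →
    SWalk f u u (v ∷ vs) true × Unique (v ∷ vs)

  Path : BN n → Fin n → Fin n → Set
  Path f = Star (Arc f)

  Ancestor : BN n → Fin n → Fin n → Set
  Ancestor f v u = Path f v u

  InPosSCC : BN n → Fin n → Set
  InPosSCC f u = Σ (Fin n) λ v → OnPosCycle f v × Path f u v × Path f v u

  Step : BN n → State n → State n → Set
  Step g z w = Σ (Fin n) λ u →
    (lookup (g z) u ≢ lookup z u) × (w ≡ z [ u ]≔ not (lookup z u))

  Reach : BN n → State n → State n → Set
  Reach g = Star (Step g)

  record IsAttractor (g : BN n) (A : State n → Set) : Set where
    field
      nonempty  : Σ (State n) A
      connected : ∀ a b → A a → A b → Reach g a b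
      closed    : ∀ a b → A a → Step g a b → A b

  IsFixedPointAttractor : BN n → (State n → Set) → Set
  IsFixedPointAttractor g A = Σ (State n) λ z →
    (∀ w → (A w → w ≡ z) × (w ≡ z → A w)) × (g z ≡ z)

  AllAttractorsFixed : BN n → Set₁
  AllAttractorsFixed g = ∀ (A : State n → Set) → IsAttractor g A → IsFixedPointAttractor g A

  fixTo : (Fin n → Bool) → State n → BN n → BN n
  fixTo W y f z = tabulate λ u → if W u then lookup y u else lookup (f z) u

  override : (Fin n → Bool) → State n → State n → State n
  override W x y = tabulate λ u → if W u then lookup y u else lookup x u

-- (i) f_u depends only on the in-neighbours of u: if f_u(z) ≠ f_u(y), walking from z to y one
-- coordinate at a time some single change j flips f_u, which is an arc j → u.
-- (ii) In f' = fixTo W y f every state reaches y.  Let D be the set where z disagrees with y; if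
-- some vertex of D can move, flipping it decreases the Hamming distance to y.  Otherwise every
-- c ∈ D is outside W with f_c(z) = z_c ≠ y_c = f_c(y), so by (i) c has an in-neighbour j ∈ D,
-- and the arc j → c has sign "z_j = z_c".  Following such predecessors inside D closes a simple
-- cycle whose signs telescope to "z_u = z_u", i.e. a positive cycle lying outside W: impossible.
module Submission where

open import Defs
open import Data.Nat using (ℕ; zero; suc; _+_; _≤_; _<_; _≤?_)
open import Data.Nat.Properties using (+-monoʳ-<; n<1+n; ≰⇒>; m≤m+n; +-suc; ≤-trans; n≮n)
open import Data.Nat.Induction using (<-wellFounded)
open import Data.Bool using (Bool; true; false; not; if_then_else_) renaming (_≟_ to _≟ᵇ_)
open import Data.Bool.Properties using (¬-not)
open import Data.Fin using (Fin; zero; suc; _≟_)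
open import Data.Fin.Properties using (any?; pigeonhole; <⇒≢)
open import Data.Vec using (Vec; []; _∷_; lookup; _[_]≔_)
open import Data.Vec.Properties using (lookup∘tabulate; tabulate∘lookup; tabulate-cong)
open import Data.List using (List; []; _∷_; length)
import Data.List as List
open import Data.List.Relation.Unary.Any using (here; there)
open import Data.List.Relation.Unary.All using ([]; _∷_)
import Data.List.Relation.Unary.All as All
open import Data.List.Relation.Unary.All.Properties using (¬Any⇒All¬; anti-mono)
open import Data.List.Relation.Unary.AllPairs using ([]; _∷_)
open import Data.List.Relation.Unary.Unique.Propositional using (Unique)
open import Data.List.Membership.Propositional using (_∈_; _∉_)
open import Data.List.Membership.Propositional.Properties using (∈-lookup)
open import Data.List.Relation.Binary.Subset.Propositional using (_⊆_)
open import Data.List.Relation.Binary.Subset.Propositional.Properties using (∷⁺ʳ)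
open import Data.Product using (Σ; _×_; _,_; proj₁; proj₂)
open import Data.Sum using (inj₁; inj₂)
open import Data.Empty using (⊥-elim)
open import Function using (_∘_)
open import Induction.WellFounded using (Acc; acc)
open import Relation.Nullary using (¬_; yes; no; contradiction)
open import Relation.Nullary.Decidable using (¬?; _×-dec_; decidable-stable)
open import Relation.Binary.PropositionalEquality using (_≡_; _≢_; refl; sym; trans; cong; subst)
open import Relation.Binary.Construct.Closure.ReflexiveTransitive using (ε; _◅_)

_==_ : Bool → Bool → Bool
a == b = if a then b else not b

==-refl : ∀ a → a == a ≡ true
==-refl false = refl
==-refl true  = refl

==-trans : ∀ a b c → (a == b) == (b == c) ≡ a == c
==-trans false false false = refl
==-trans false false true  = refl
==-trans false true  false = refl
==-trans false true  true  = refl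
==-trans true  false false = refl
==-trans true  false true  = refl
==-trans true  true  false = refl
==-trans true  true  true  = refl

Unique⇒lookup-injective : ∀ {a} {A : Set a} {xs : List A} → Unique xs →
  ∀ i j → List.lookup xs i ≡ List.lookup xs j → i ≡ j
Unique⇒lookup-injective (_ ∷ _)    zero    zero    _  = refl
Unique⇒lookup-injective (x∉ ∷ _)   zero    (suc j) eq = ⊥-elim (All.lookup x∉ (∈-lookup j) eq)
Unique⇒lookup-injective (x∉ ∷ _)   (suc i) zero    eq = ⊥-elim (All.lookup x∉ (∈-lookup i) (sym eq))
Unique⇒lookup-injective (_ ∷ uxs)  (suc i) (suc j) eq = cong suc (Unique⇒lookup-injective uxs i j eq)

Unique⇒length≤ : ∀ {n} {xs : List (Fin n)} → Unique xs → length xs ≤ n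
Unique⇒length≤ {n} {xs} u with length xs ≤? n
... | yes bound = bound
... | no ¬bound with pigeonhole (≰⇒> ¬bound) (List.lookup xs)
...   | i , j , i<j , eq = contradiction (Unique⇒lookup-injective u i j eq) (<⇒≢ i<j)

-- Walking from a to b one coordinate at a time, the value of h has to flip at some step.
sensitive-coordinate : ∀ {m} (h : Vec Bool m → Bool) (a b : Vec Bool m) → h a ≢ h b →
  Σ (Fin m) λ j → lookup a j ≢ lookup b j × Σ (Vec Bool m) λ w →
    h (w [ j ]≔ lookup a j) ≡ h a × h (w [ j ]≔ lookup b j) ≡ h b
sensitive-coordinate h [] [] ha≢hb = ⊥-elim (ha≢hb refl)
sensitive-coordinate h (x ∷ as) (y ∷ bs) ha≢hb with h (x ∷ bs) ≟ᵇ h (x ∷ as)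
... | yes same = zero , x≢y , x ∷ bs , same , refl
  where
  x≢y : x ≢ y
  x≢y x≡y = ha≢hb (trans (sym same) (cong (λ t → h (t ∷ bs)) x≡y))
... | no differ with sensitive-coordinate (λ v → h (x ∷ v)) as bs (differ ∘ sym)
...   | j , d , w , e₁ , e₂ =
  suc j , d , x ∷ w , e₁ , trans e₂ (trans (¬-not differ) (sym (¬-not (ha≢hb ∘ sym))))

module _ {n : ℕ} (E : Fin n → Fin n → Set) where

  open import Data.List.Membership.DecPropositional (_≟_ {n}) using (_∈?_)

  data Walk : Fin n → Fin n → List (Fin n) → Set where
    []  : ∀ {u} → Walk u u []
    _∷_ : ∀ {u v w vs} → E u v → Walk v w vs → Walk u w (u ∷ vs)

  walk-prefix : ∀ {c t p L} → Walk c t L → Unique L → p ∈ L →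
    Σ (List (Fin n)) λ pre → Walk c p pre × Unique (p ∷ pre) × pre ⊆ L
  walk-prefix (e ∷ w) _ (here refl) = [] , [] , [] ∷ [] , λ ()
  walk-prefix {c} (e ∷ w) (c∉L ∷ uL) (there p∈L) with walk-prefix w uL p∈L
  ... | pre , w′ , p∉pre ∷ u-pre , pre⊆L =
    c ∷ pre , e ∷ w′ ,
    ((λ p≡c → All.lookup c∉L p∈L (sym p≡c)) ∷ p∉pre) ∷ (anti-mono pre⊆L c∉L ∷ u-pre) ,
    ∷⁺ʳ c pre⊆L

  SimpleCycleIn : (Fin n → Set) → Set
  SimpleCycleIn P = Σ (Fin n) λ u → P u × Σ (List (Fin n)) λ vs → Walk u u (u ∷ vs) × Unique (u ∷ vs)

  simple-cycle : (P : Fin n → Set) → (∀ {c} → P c → Σ (Fin n) λ j → P j × E j c) →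
    ∀ {c} → P c → SimpleCycleIn P
  simple-cycle P predecessor Pc = grow n (m≤m+n n 0) [] ([] ∷ []) Pc
    where
    insert-fresh : ∀ {t p L} → Unique (t ∷ L) → p ∉ t ∷ L → Unique (t ∷ p ∷ L)
    insert-fresh {L = L} (t∉L ∷ uL) p∉ =
      ((λ t≡p → p∉ (here (sym t≡p))) ∷ t∉L) ∷ (¬Any⇒All¬ L (p∉ ∘ there) ∷ uL)

    close : ∀ {p c t L} → E p c → Walk c t L → Unique (t ∷ L) → p ∈ t ∷ L →
      Σ (List (Fin n)) λ vs → Walk p p (p ∷ vs) × Unique (p ∷ vs)
    close e w u (here refl) = _ , e ∷ w , u
    close e w (_ ∷ uL) (there p∈L) with walk-prefix w uL p∈L
    ... | pre , w′ , u′ , _ = pre , e ∷ w′ , u′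

    -- The walk is extended backwards while it stays simple, which it can do fewer than n times.
    grow : ∀ k {c t L} → n ≤ k + length L → Walk c t L → Unique (t ∷ L) → P c → SimpleCycleIn P
    grow zero fuel _ u _ = ⊥-elim (n≮n _ (≤-trans (Unique⇒length≤ u) fuel))
    grow (suc k) {c} {t} {L} fuel w u Pc with predecessor Pc
    ... | p , Pp , e with p ∈? t ∷ L
    ...   | yes p∈ = p , Pp , close e w u p∈
    ...   | no p∉ = grow k (subst (n ≤_) (sym (+-suc k (length L))) fuel) (e ∷ w) (insert-fresh u p∉) Pp

module _ {n : ℕ} (f : BN n) where

  arc-of-change : ∀ {j c} (w : State n) a a′ →
    lookup (f (w [ j ]≔ a)) c ≡ a′ → lookup (f (w [ j ]≔ not a)) c ≡ not a′ →
    SArc f (a == a′) j c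
  arc-of-change w false false e₁ e₂ = w , e₁ , e₂
  arc-of-change w false true  e₁ e₂ = w , e₁ , e₂
  arc-of-change w true  false e₁ e₂ = w , e₂ , e₁
  arc-of-change w true  true  e₁ e₂ = w , e₂ , e₁

  differing-outputs⇒arc : ∀ {z z′ : State n} {c} → lookup (f z) c ≢ lookup (f z′) c →
    Σ (Fin n) λ j → lookup z j ≢ lookup z′ j × SArc f (lookup z j == lookup (f z) c) j c
  differing-outputs⇒arc {z} {z′} {c} ne
    with sensitive-coordinate (λ s → lookup (f s) c) z z′ ne
  ... | j , d , w , e₁ , e₂ = j , d , arc-of-change w (lookup z j) (lookup (f z) c) e₁ e₂′
    where
    e₂′ : lookup (f (w [ j ]≔ not (lookup z j))) c ≡ not (lookup (f z) c)
    e₂′ = subst (λ b → lookup (f (w [ j ]≔ b)) c ≡ not (lookup (f z) c))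
                (¬-not (d ∘ sym)) (trans e₂ (¬-not (ne ∘ sym)))

  in-neighbours-determine : ∀ {u} {z z′ : State n} →
    (∀ v → Arc f v u → lookup z v ≡ lookup z′ v) → lookup (f z) u ≡ lookup (f z′) u
  in-neighbours-determine {u} {z} {z′} agree =
    decidable-stable (lookup (f z) u ≟ᵇ lookup (f z′) u) λ ne →
      let j , d , arc = differing-outputs⇒arc ne in d (agree j (toArc arc))
    where
    toArc : ∀ {s j} → SArc f s j u → Arc f j u
    toArc {true}  = inj₁
    toArc {false} = inj₂

  -- Arcs whose sign records whether z agrees at their two ends: along a walk these signs
  -- telescope, so every closed such walk is positive.
  AgreementArc : State n → Fin n → Fin n → Set
  AgreementArc z j i = SArc f (lookup z j == lookup z i) j i

  agreement-walk⇒signed-walk : ∀ (z : State n) {c t L} → Walk (AgreementArc z) c t L →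
    SWalk f c t L (lookup z c == lookup z t)
  agreement-walk⇒signed-walk z {c} [] = subst (SWalk f c c []) (sym (==-refl (lookup z c))) []
  agreement-walk⇒signed-walk z {c} {t} (_∷_ {v = v} arc w) =
    subst (SWalk f c t _) (==-trans (lookup z c) (lookup z v) (lookup z t))
          (arc ∷ agreement-walk⇒signed-walk z w)

hamming : ∀ {m} → Vec Bool m → Vec Bool m → ℕ
hamming []       []       = 0
hamming (a ∷ as) (b ∷ bs) = (if a == b then 0 else 1) + hamming as bs

hamming-flip : ∀ {m} (a b : Vec Bool m) i → lookup a i ≢ lookup b i →
  hamming (a [ i ]≔ not (lookup a i)) b < hamming a b
hamming-flip (false ∷ _)  (false ∷ _)  zero    ne = ⊥-elim (ne refl)
hamming-flip (false ∷ as) (true ∷ bs)  zero    _  = n<1+n (hamming as bs)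
hamming-flip (true ∷ as)  (false ∷ bs) zero    _  = n<1+n (hamming as bs)
hamming-flip (true ∷ _)   (true ∷ _)   zero    ne = ⊥-elim (ne refl)
hamming-flip (a ∷ as)     (b ∷ bs)     (suc i) ne =
  +-monoʳ-< (if a == b then 0 else 1) (hamming-flip as bs i ne)

module _ {n : ℕ} where

  DisagreementsFrozen : BN n → State n → State n → Set
  DisagreementsFrozen g y z = ∀ i → lookup z i ≢ lookup y i → lookup (g z) i ≡ lookup z i

  reach-by-descent : ∀ {g : BN n} {y : State n} →
    (∀ z → DisagreementsFrozen g y z → z ≡ y) → ∀ z → Reach g z y
  reach-by-descent {g} {y} only-y z = descend z (<-wellFounded (hamming z y))
    where
    descend : ∀ z → Acc _<_ (hamming z y) → Reach g z y
    descend z (acc smaller)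
      with any? (λ i → ¬? (lookup z i ≟ᵇ lookup y i) ×-dec ¬? (lookup (g z) i ≟ᵇ lookup z i))
    ... | yes (i , dis , moves) = (i , moves , refl) ◅ descend _ (smaller (hamming-flip z y i dis))
    ... | no none with only-y z frozen
      where
      frozen : DisagreementsFrozen g y z
      frozen i dis = decidable-stable (lookup (g z) i ≟ᵇ lookup z i) λ moves → none (i , dis , moves)
    ...   | refl = ε

  frozen-disagreement-under-fixTo : ∀ (W : Fin n → Bool) (y : State n) (f : BN n) z i →
    lookup (fixTo W y f z) i ≡ lookup z i → lookup z i ≢ lookup y i →
    W i ≡ false × lookup (f z) i ≡ lookup z i
  frozen-disagreement-under-fixTo W y f z i frozen dis
    with W i | lookup∘tabulate (λ u → if W u then lookup y u else lookup (f z) u) i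
  ... | true  | fixed = ⊥-elim (dis (trans (sym frozen) fixed))
  ... | false | free  = refl , trans (sym free) frozen

  fixing-positive-cycles⇒only-y-frozen : ∀ {f : BN n} {y : State n} → f y ≡ y →
    ∀ {W : Fin n → Bool} → (∀ u → OnPosCycle f u → W u ≡ true) →
    ∀ z → DisagreementsFrozen (fixTo W y f) y z → z ≡ y
  fixing-positive-cycles⇒only-y-frozen {f} {y} fy {W} W⊇cycles z frozen =
    trans (sym (tabulate∘lookup z)) (trans (tabulate-cong agree) (tabulate∘lookup y))
    where
    Disagree : Fin n → Set
    Disagree i = lookup z i ≢ lookup y i

    predecessor : ∀ {c} → Disagree c → Σ (Fin n) λ j → Disagree j × AgreementArc f z j c
    predecessor {c} dis with frozen-disagreement-under-fixTo W y f z c (frozen c dis) dis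
    ... | _ , f-frozen
      with differing-outputs⇒arc f {z} {y} {c}
             (λ same → dis (trans (sym f-frozen) (trans same (cong (λ s → lookup s c) fy))))
    ...   | j , d , arc = j , d , subst (λ b → SArc f (lookup z j == b) j c) f-frozen arc

    agree : ∀ i → lookup z i ≡ lookup y i
    agree i = decidable-stable (lookup z i ≟ᵇ lookup y i) λ dis →
      let u , dis-u , vs , cycle , simple = simple-cycle (AgreementArc f z) Disagree predecessor dis
          positive = subst (SWalk f u u (u ∷ vs)) (==-refl (lookup z u))
                           (agreement-walk⇒signed-walk f z cycle)
      in contradiction (trans (sym (W⊇cycles u (u , vs , positive , simple)))
                              (proj₁ (frozen-disagreement-under-fixTo W y f z u (frozen u dis-u) dis-u))) λ ()

theorem2 : ∀ (n : ℕ) (f : BN n) (x y : State n) →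
    AllAttractorsFixed f → f x ≡ x → f y ≡ y →
    (∀ (u : Fin n) → lookup x u ≢ lookup y u → ¬ OnPosCycle f u →
       ∀ (z : State n) → (∀ v → Ancestor f v u → lookup z v ≡ lookup y v) →
       lookup (f z) u ≡ lookup y u)
    ×
    (∀ (W : Fin n → Bool) → (∀ u → (W u ≡ true → InPosSCC f u) × (InPosSCC f u → W u ≡ true)) →
       ∀ (z : State n) → Reach (fixTo W y f) (override W x y) z →
       Reach (fixTo W y f) z y)
theorem2 n f x y _ _ fy =
  (λ u _ _ z agree → trans (in-neighbours-determine f λ v arc → agree v (arc ◅ ε))
                           (cong (λ s → lookup s u) fy)) ,
  (λ W W≡posSCC z _ → reach-by-descent {g = fixTo W y f}
     (fixing-positive-cycles⇒only-y-frozen fy λ u cycle → proj₂ (W≡posSCC u) (u , cycle , ε , ε)) z)
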